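{- Let $r\ge 1$ and let $(G,R)$ be a $2$-coloring of $AG(r-1,2)$. Then $AG(r-1,2)|G$ is an affine target if and only if $AG(r-1,2)|G$ does not contain $U_{4,4}$ as an induced restriction.
   Context: All matroids are simple. $AG(r-1,q)$ denotes the rank-$r$ affine geometry over $GF(q)$ (equivalently, $PG(r-1,q)$ with a projective hyperplane deleted); its flats are called affine flats. A $2$-coloring $(G,R)$ of $AG(r-1,q)$ is a partition of its ground set into possibly empty sets $G$ (green) and $R$ (red). A nested sequence of affine flats is a sequence $(F_0,\dots,F_k)$ of possibly empty affine flats with $\emptyset=F_0\subseteq F_1\subseteq\dots\subseteq F_k=E(AG(r-1,q))$. For $X\subseteq E(AG(r-1,q))$, $AG(r-1,q)|X$ is an affine target if there is a nested sequence of affine flats $(F_0,\dots,F_k)$ such that $X$ is the union of the sets $F_{i+1}-F_i$ over all even $i$ with $0\le i\le k-1$. An induced restriction of a matroid $M$ is a restriction of $M$ to one of its flats; $M$ contains $N$ as an induced restriction if $M|F\cong N$ for some flat $F$ of $M$. -}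

module Defs where

open import Data.Bool using (Bool; true; false; _xor_)
open import Data.Nat using (ℕ; zero; suc; _+_; _<_)
open import Data.Vec using (Vec; []; _∷_; zipWith; replicate)
open import Data.List using (List; []; _∷_; length; map; foldr)
open import Data.List.Relation.Unary.All using (All)
open import Data.List.Relation.Unary.Unique.Propositional using (Unique)
open import Data.List.Relation.Binary.Sublist.Propositional using (_⊆_)
open import Data.List.Membership.Propositional using (_∈_)
open import Data.Product using (Σ; ∃; ∃-syntax; _×_)
open import Data.Sum using (_⊎_)
open import Relation.Binary.PropositionalEquality using (_≡_; _≢_)
open import Relation.Nullary using (¬_)

-- GF(2) is modelled by Bool, with addition _xor_.
-- Points of AG(r-1,2), r = suc n: vectors of GF(2)^n.
Point : ℕ → Set
Point n = Vec Bool n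

_⊕_ : ∀ {m} → Vec Bool m → Vec Bool m → Vec Bool m
_⊕_ = zipWith _xor_

infixl 6 _⊕_

0v : ∀ {m} → Vec Bool m
0v = replicate _ false

-- A subset of the ground set E(AG(n,2)) (decidable, as the ground set is finite).
Subset : ℕ → Set
Subset n = Point n → Bool

-- AG(r-1,2) as PG(r-1,2) minus the hyperplane {x₀ = 0}: the point p is
-- the vector (1,p) of GF(2)^r, and AG(r-1,2) is the vector matroid of
-- these vectors.

lift : ∀ {n} → Point n → Vec Bool (suc n)
lift p = true ∷ p

sumV : ∀ {m} → List (Vec Bool m) → Vec Bool m
sumV = foldr _⊕_ 0v

-- Linear independence over GF(2) of the lifted points of a finite set
-- (given as a duplicate-free list): no nonempty subset sums to zero.
Indep : ∀ {n} → List (Point n) → Set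
Indep L = Unique L × (∀ S → S ⊆ L → S ≢ [] → sumV (map lift S) ≢ 0v)

InSpan : ∀ {n} → List (Point n) → Point n → Set
InSpan L x = ∃[ S ] (S ⊆ L × sumV (map lift S) ≡ lift x)

-- F is a flat of the restriction AG(n,2)|G: F ⊆ G and F is closed in it
-- (closure in a restriction M|G is cl_M(F) ∩ G).
IsFlatOfRestriction : ∀ {n} → Subset n → List (Point n) → Set
IsFlatOfRestriction G F =
  All (λ y → G y ≡ true) F × (∀ x → G x ≡ true → InSpan F x → x ∈ F)

-- (AG(n,2)|G)|F ≅ U_{4,4}: F has exactly 4 elements and every subset of F
-- is independent (every subset of the ground set of U_{4,4} is independent).
RestrictionIsoU44 : ∀ {n} → List (Point n) → Set
RestrictionIsoU44 F = length F ≡ 4 × Unique F × (∀ S → S ⊆ F → Indep S)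

ContainsU44Induced : ∀ {n} → Subset n → Set
ContainsU44Induced G =
  ∃[ F ] (IsFlatOfRestriction G F × RestrictionIsoU44 F)

IsSubspace : ∀ {n} → Subset n → Set
IsSubspace W = W 0v ≡ true × (∀ x y → W x ≡ true → W y ≡ true → W (x ⊕ y) ≡ true)
-- (closure under scalar multiplication is automatic over GF(2) given 0 ∈ W)

IsAffineFlat : ∀ {n} → Subset n → Set
IsAffineFlat F = (∀ x → F x ≡ false) ⊎ (∃[ v ] IsSubspace (λ x → F (x ⊕ v)))

Even : ℕ → Set
Even i = ∃[ j ] i ≡ j + j

-- AG(n,2)|X is an affine target: there is a nested sequence of affine flats
-- ∅ = F 0 ⊆ F 1 ⊆ … ⊆ F k = E with X = ⋃_{i even, i < k} (F (i+1) − F i).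
-- (Values F i for i > k are irrelevant.)
IsAffineTarget : ∀ {n} → Subset n → Set
IsAffineTarget {n} X =
  Σ ℕ λ k → Σ (ℕ → Subset n) λ F → (
      (∀ i → i < suc k → IsAffineFlat (F i))
    × (∀ x → F 0 x ≡ false)
    × (∀ i x → i < k → F i x ≡ true → F (suc i) x ≡ true)
    × (∀ x → F k x ≡ true)
    × (∀ x → X x ≡ true → ∃[ i ] (i < k × Even i × F (suc i) x ≡ true × F i x ≡ false))
    × (∀ x i → i < k → Even i → F (suc i) x ≡ true → F i x ≡ false → X x ≡ true))

{-# OPTIONS --safe #-}
-- An induced U_{4,4} of AG(n,2)|G is a frame: four affinely independent
-- points of G whose four sums of three lie outside G.
--
-- A target has no frame: in the first flat of its nested sequence containing
-- the four points, the points whose colour is not that of their layer lie in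
-- the flat below, and then so do all eight points, by closure under sums of
-- three.
--
-- Conversely, a frame-free colouring of AG(n,2), n ≥ 1, has a monochromatic
-- affine hyperplane: by induction, the two halves x₀ = 0 and x₀ = 1 have
-- monochromatic hyperplanes, and every way in which these fail to combine
-- into one of the whole space exhibits a frame. Peeling off such hyperplanes
-- one at a time, the complement being a copy of AG(n-1,2), describes G by a
-- decision list of hyperplanes. Read backwards, the list is a nested sequence
-- of flats, each new layer coloured by its hyperplane.
module Submission where

open import Defs
open import Algebra.Definitions using (Associative; Commutative; RightIdentity)
open import Data.Bool using (Bool; true; false; not; _∧_; _xor_; if_then_else_)
open import Data.Bool.Properties
  using (xor-assoc; xor-comm; xor-same; xor-identityˡ; xor-identityʳ; ¬-not; not-¬; not-involutive;
         ∧-distribˡ-xor; ∧-zeroʳ; ∧-identityʳ)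
  renaming (_≟_ to _≟ᵇ_)
open import Data.Empty using (⊥; ⊥-elim)
open import Data.Fin using (Fin; zero; suc)
open import Data.List using (List; []; _∷_; foldr; map)
open import Data.List.Membership.Propositional using (_∈_; _∉_)
open import Data.List.Relation.Binary.Sublist.Propositional using (_⊆_; []; _∷_; _∷ʳ_; ⊆-refl; ⊆-trans)
open import Data.List.Relation.Binary.Sublist.Propositional.Properties using (All-resp-⊆)
open import Data.List.Relation.Unary.All using (All; []; _∷_; all?)
open import Data.List.Relation.Unary.AllPairs using (AllPairs; []; _∷_)
open import Data.List.Relation.Unary.Any using (here; there)
open import Data.List.Relation.Unary.Unique.Propositional using (Unique)
open import Data.Nat using (ℕ; zero; suc; _+_; _≤_; _<_; _≤?_; s≤s; z≤n)
open import Data.Nat.Properties using (≤-refl; ≤-pred; <⇒≤; n<1+n; m<n⇒m<1+n; +-suc; <-cmp; <-irrefl; m≤n⇒m<n∨m≡n)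
open import Data.Product using (∃-syntax; _×_; _,_; proj₁; proj₂)
open import Data.Sum using (_⊎_; inj₁; inj₂)
open import Data.Vec using (Vec; []; _∷_; lookup; insertAt; removeAt)
open import Data.Vec.Properties
  using (zipWith-assoc; zipWith-comm; zipWith-identityˡ; zipWith-identityʳ; ∷-injectiveʳ;
         insertAt-lookup; removeAt-insertAt; insertAt-removeAt)
open import Function using (_∘_; Injective)
open import Function.Bundles using (_⇔_; mk⇔)
open import Relation.Binary.Definitions using (tri<; tri≈; tri>)
open import Relation.Binary.PropositionalEquality using (_≡_; _≢_; refl; sym; trans; cong; cong₂; subst; module ≡-Reasoning)
open import Relation.Nullary using (¬_; Dec; yes; no; does; contradiction; contraposition)
open import Relation.Nullary.Decidable using (dec-true; dec-false; _→-dec_; _×-dec_)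
open import Relation.Unary using (Decidable)

-- Identities in groups of exponent 2, and GF(2)^n

module BooleanGroupSolver {A : Set} (_∙_ : A → A → A) (ε : A)
  (∙-assoc : Associative _≡_ _∙_) (∙-comm : Commutative _≡_ _∙_)
  (∙-identityʳ : RightIdentity _≡_ ε _∙_) (∙-self : ∀ x → x ∙ x ≡ ε) where

  infixl 6 _:∙_

  data Expr (k : ℕ) : Set where
    var : Fin k → Expr k
    :ε : Expr k
    _:∙_ : Expr k → Expr k → Expr k

  ⟦_⟧ : ∀ {k} → Expr k → Vec A k → A
  ⟦ var i ⟧ ρ = lookup ρ i
  ⟦ :ε ⟧ ρ = ε
  ⟦ e₁ :∙ e₂ ⟧ ρ = ⟦ e₁ ⟧ ρ ∙ ⟦ e₂ ⟧ ρ

  -- A normal form records which variables occur an odd number of times.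
  Normal : ℕ → Set
  Normal = Vec Bool

  ⟦_⟧⇓ : ∀ {k} → Normal k → Vec A k → A
  ⟦ [] ⟧⇓ [] = ε
  ⟦ b ∷ bs ⟧⇓ (x ∷ ρ) = (if b then x else ε) ∙ ⟦ bs ⟧⇓ ρ

  :ε⇓ : ∀ {k} → Normal k
  :ε⇓ {zero} = []
  :ε⇓ {suc k} = false ∷ :ε⇓

  var⇓ : ∀ {k} → Fin k → Normal k
  var⇓ zero = true ∷ :ε⇓
  var⇓ (suc i) = false ∷ var⇓ i

  _∙⇓_ : ∀ {k} → Normal k → Normal k → Normal k
  [] ∙⇓ [] = []
  (b ∷ bs) ∙⇓ (c ∷ cs) = (b xor c) ∷ (bs ∙⇓ cs)

  normalise : ∀ {k} → Expr k → Normal k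
  normalise (var i) = var⇓ i
  normalise :ε = :ε⇓
  normalise (e₁ :∙ e₂) = normalise e₁ ∙⇓ normalise e₂

  ∙-identityˡ : ∀ x → ε ∙ x ≡ x
  ∙-identityˡ x = trans (∙-comm ε x) (∙-identityʳ x)

  ∙-interchange : ∀ w x y z → (w ∙ x) ∙ (y ∙ z) ≡ (w ∙ y) ∙ (x ∙ z)
  ∙-interchange w x y z = begin
    (w ∙ x) ∙ (y ∙ z)  ≡⟨ ∙-assoc w x (y ∙ z) ⟩
    w ∙ (x ∙ (y ∙ z))  ≡⟨ cong (w ∙_) (sym (∙-assoc x y z)) ⟩
    w ∙ ((x ∙ y) ∙ z)  ≡⟨ cong (λ u → w ∙ (u ∙ z)) (∙-comm x y) ⟩
    w ∙ ((y ∙ x) ∙ z)  ≡⟨ cong (w ∙_) (∙-assoc y x z) ⟩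
    w ∙ (y ∙ (x ∙ z))  ≡⟨ sym (∙-assoc w y (x ∙ z)) ⟩
    (w ∙ y) ∙ (x ∙ z)  ∎
    where open ≡-Reasoning

  if-xor : ∀ b c x → (if b xor c then x else ε) ≡ (if b then x else ε) ∙ (if c then x else ε)
  if-xor false c x = sym (∙-identityˡ _)
  if-xor true false x = sym (∙-identityʳ x)
  if-xor true true x = sym (∙-self x)

  :ε⇓-correct : ∀ {k} (ρ : Vec A k) → ⟦ :ε⇓ ⟧⇓ ρ ≡ ε
  :ε⇓-correct [] = refl
  :ε⇓-correct (x ∷ ρ) = trans (∙-identityˡ _) (:ε⇓-correct ρ)

  var⇓-correct : ∀ {k} (i : Fin k) ρ → ⟦ var⇓ i ⟧⇓ ρ ≡ lookup ρ i
  var⇓-correct zero (x ∷ ρ) = trans (cong (x ∙_) (:ε⇓-correct ρ)) (∙-identityʳ x)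
  var⇓-correct (suc i) (x ∷ ρ) = trans (∙-identityˡ _) (var⇓-correct i ρ)

  ∙⇓-correct : ∀ {k} (u v : Normal k) ρ → ⟦ u ∙⇓ v ⟧⇓ ρ ≡ ⟦ u ⟧⇓ ρ ∙ ⟦ v ⟧⇓ ρ
  ∙⇓-correct [] [] [] = sym (∙-identityʳ ε)
  ∙⇓-correct (b ∷ u) (c ∷ v) (x ∷ ρ) =
    trans (cong₂ _∙_ (if-xor b c x) (∙⇓-correct u v ρ))
          (∙-interchange _ _ _ _)

  normalise-correct : ∀ {k} (e : Expr k) ρ → ⟦ e ⟧ ρ ≡ ⟦ normalise e ⟧⇓ ρ
  normalise-correct (var i) ρ = sym (var⇓-correct i ρ)
  normalise-correct :ε ρ = sym (:ε⇓-correct ρ)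
  normalise-correct (e₁ :∙ e₂) ρ =
    trans (cong₂ _∙_ (normalise-correct e₁ ρ) (normalise-correct e₂ ρ))
          (sym (∙⇓-correct (normalise e₁) (normalise e₂) ρ))

  solve : ∀ {k} (e₁ e₂ : Expr k) → normalise e₁ ≡ normalise e₂ → ∀ ρ → ⟦ e₁ ⟧ ρ ≡ ⟦ e₂ ⟧ ρ
  solve e₁ e₂ eq ρ = trans (normalise-correct e₁ ρ) (trans (cong (λ u → ⟦ u ⟧⇓ ρ) eq) (sym (normalise-correct e₂ ρ)))

  :sum₃ : ∀ {k} → Expr k → Expr k → Expr k → Expr k
  :sum₃ e₁ e₂ e₃ = e₁ :∙ (e₂ :∙ (e₃ :∙ :ε))

  :sum₄ : ∀ {k} → Expr k → Expr k → Expr k → Expr k → Expr k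
  :sum₄ e₁ e₂ e₃ e₄ = e₁ :∙ :sum₃ e₂ e₃ e₄

  x₀ : ∀ {k} → Expr (suc k)
  x₀ = var zero
  x₁ : ∀ {k} → Expr (2 + k)
  x₁ = var (suc zero)
  x₂ : ∀ {k} → Expr (3 + k)
  x₂ = var (suc (suc zero))
  x₃ : ∀ {k} → Expr (4 + k)
  x₃ = var (suc (suc (suc zero)))

⊕-assoc : ∀ {m} → Associative _≡_ (_⊕_ {m})
⊕-assoc = zipWith-assoc xor-assoc

⊕-comm : ∀ {m} → Commutative _≡_ (_⊕_ {m})
⊕-comm = zipWith-comm xor-comm

⊕-identityˡ : ∀ {m} (x : Vec Bool m) → 0v ⊕ x ≡ x
⊕-identityˡ = zipWith-identityˡ xor-identityˡ

⊕-identityʳ : ∀ {m} (x : Vec Bool m) → x ⊕ 0v ≡ x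
⊕-identityʳ = zipWith-identityʳ xor-identityʳ

⊕-self : ∀ {m} (x : Vec Bool m) → x ⊕ x ≡ 0v
⊕-self [] = refl
⊕-self (b ∷ x) = cong₂ _∷_ (xor-same b) (⊕-self x)

module ⊕-Solver {m : ℕ} = BooleanGroupSolver (_⊕_ {m}) 0v ⊕-assoc ⊕-comm ⊕-identityʳ ⊕-self
open ⊕-Solver using (solve; x₀; x₁; x₂; x₃; _:∙_; :ε; :sum₃; :sum₄)
open BooleanGroupSolver _xor_ false xor-assoc xor-comm xor-identityʳ xor-same
  using ()
  renaming (solve to solveᵇ; _:∙_ to infixl 6 _:xor_; :sum₃ to :xor₃; x₀ to b₀; x₁ to b₁; x₂ to b₂; x₃ to b₃;
            ∙-interchange to xor-interchange)

≡⇒⊕≡0 : ∀ {m} {x y : Vec Bool m} → x ≡ y → x ⊕ y ≡ 0v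
≡⇒⊕≡0 {x = x} refl = ⊕-self x

⊕-cancelʳ : ∀ {m} {x y z : Vec Bool m} → x ⊕ z ≡ y ⊕ z → x ≡ y
⊕-cancelʳ {x = x} {y} {z} e = begin
  x            ≡⟨ solve x₀ (x₀ :∙ x₁ :∙ x₁) refl (x ∷ z ∷ []) ⟩
  x ⊕ z ⊕ z    ≡⟨ cong (_⊕ z) e ⟩
  y ⊕ z ⊕ z    ≡⟨ solve (x₀ :∙ x₁ :∙ x₁) x₀ refl (y ∷ z ∷ []) ⟩
  y            ∎
  where open ≡-Reasoning

⊕≡0⇒≡ : ∀ {m} {x y : Vec Bool m} → x ⊕ y ≡ 0v → x ≡ y
⊕≡0⇒≡ {y = y} e = ⊕-cancelʳ (trans e (sym (⊕-self y)))

x≡x⊕y⇒y≡0 : ∀ {m} {x y : Vec Bool m} → x ≡ x ⊕ y → y ≡ 0v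
x≡x⊕y⇒y≡0 {x = x} {y} e = begin
  y              ≡⟨ solve x₁ (x₀ :∙ (x₀ :∙ x₁)) refl (x ∷ y ∷ []) ⟩
  x ⊕ (x ⊕ y)    ≡⟨ cong (x ⊕_) (sym e) ⟩
  x ⊕ x          ≡⟨ ⊕-self x ⟩
  0v             ∎
  where open ≡-Reasoning

sum₃ : ∀ {m} → Vec Bool m → Vec Bool m → Vec Bool m → Vec Bool m
sum₃ x y z = sumV (x ∷ y ∷ z ∷ [])

sum₄ : ∀ {m} → Vec Bool m → Vec Bool m → Vec Bool m → Vec Bool m → Vec Bool m
sum₄ w x y z = sumV (w ∷ x ∷ y ∷ z ∷ [])

-- Frames

-- The sums of three are the points other than a, b, c, d spanned by their
-- lifts; the last seven fields say that the four lifts are independent.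
record Frame {n} (G : Subset n) (a b c d : Point n) : Set where
  field
    a∈G : G a ≡ true
    b∈G : G b ≡ true
    c∈G : G c ≡ true
    d∈G : G d ≡ true
    bcd∉G : G (sum₃ b c d) ≡ false
    acd∉G : G (sum₃ a c d) ≡ false
    abd∉G : G (sum₃ a b d) ≡ false
    abc∉G : G (sum₃ a b c) ≡ false
    a≢b : a ≢ b
    a≢c : a ≢ c
    a≢d : a ≢ d
    b≢c : b ≢ c
    b≢d : b ≢ d
    c≢d : c ≢ d
    sum₄≢0 : sum₄ a b c d ≢ 0v

FrameFree : ∀ {n} → Subset n → Set
FrameFree G = ∀ {a b c d} → ¬ Frame G a b c d

sumV-pair≡0⇒≡ : ∀ {m} {x y : Vec Bool m} → sumV (x ∷ y ∷ []) ≡ 0v → x ≡ y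
sumV-pair≡0⇒≡ {y = y} e = ⊕≡0⇒≡ (trans (cong (_ ⊕_) (sym (⊕-identityʳ y))) e)

AllPairs-resp-⊆ : ∀ {A : Set} {R : A → A → Set} {xs ys : List A} → xs ⊆ ys → AllPairs R ys → AllPairs R xs
AllPairs-resp-⊆ [] [] = []
AllPairs-resp-⊆ (_ ∷ʳ p) (_ ∷ rs) = AllPairs-resp-⊆ p rs
AllPairs-resp-⊆ (refl ∷ p) (r ∷ rs) = All-resp-⊆ p r ∷ AllPairs-resp-⊆ p rs

module _ {n} {G : Subset n} {a b c d : Point n} (frame : Frame G a b c d) where
  open Frame frame

  private
    F : List (Point n)
    F = a ∷ b ∷ c ∷ d ∷ []

  private
    green≢red : ∀ {x y} → G x ≡ true → G y ≡ false → x ≢ y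
    green≢red x∈G y∉G refl with () ← trans (sym x∈G) y∉G

  -- The first coordinate of a sum of lifts is the parity of the number of
  -- summands, so only the sums of one or of three points can be lifts.
  frame-closed : ∀ x → G x ≡ true → InSpan F x → x ∈ F
  frame-closed x _ (_ , (refl ∷ _ ∷ʳ _ ∷ʳ _ ∷ʳ []) , e) = here (trans (sym (∷-injectiveʳ e)) (⊕-identityʳ a))
  frame-closed x _ (_ , (_ ∷ʳ refl ∷ _ ∷ʳ _ ∷ʳ []) , e) = there (here (trans (sym (∷-injectiveʳ e)) (⊕-identityʳ b)))
  frame-closed x _ (_ , (_ ∷ʳ _ ∷ʳ refl ∷ _ ∷ʳ []) , e) = there (there (here (trans (sym (∷-injectiveʳ e)) (⊕-identityʳ c))))
  frame-closed x _ (_ , (_ ∷ʳ _ ∷ʳ _ ∷ʳ refl ∷ []) , e) = there (there (there (here (trans (sym (∷-injectiveʳ e)) (⊕-identityʳ d)))))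
  frame-closed x x∈G (_ , (_ ∷ʳ refl ∷ refl ∷ refl ∷ []) , e) with () ← green≢red x∈G bcd∉G (sym (∷-injectiveʳ e))
  frame-closed x x∈G (_ , (refl ∷ _ ∷ʳ refl ∷ refl ∷ []) , e) with () ← green≢red x∈G acd∉G (sym (∷-injectiveʳ e))
  frame-closed x x∈G (_ , (refl ∷ refl ∷ _ ∷ʳ refl ∷ []) , e) with () ← green≢red x∈G abd∉G (sym (∷-injectiveʳ e))
  frame-closed x x∈G (_ , (refl ∷ refl ∷ refl ∷ _ ∷ʳ []) , e) with () ← green≢red x∈G abc∉G (sym (∷-injectiveʳ e))
  frame-closed x _ (_ , (_ ∷ʳ _ ∷ʳ _ ∷ʳ _ ∷ʳ []) , ())
  frame-closed x _ (_ , (refl ∷ refl ∷ _ ∷ʳ _ ∷ʳ []) , ())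
  frame-closed x _ (_ , (refl ∷ _ ∷ʳ refl ∷ _ ∷ʳ []) , ())
  frame-closed x _ (_ , (refl ∷ _ ∷ʳ _ ∷ʳ refl ∷ []) , ())
  frame-closed x _ (_ , (_ ∷ʳ refl ∷ refl ∷ _ ∷ʳ []) , ())
  frame-closed x _ (_ , (_ ∷ʳ refl ∷ _ ∷ʳ refl ∷ []) , ())
  frame-closed x _ (_ , (_ ∷ʳ _ ∷ʳ refl ∷ refl ∷ []) , ())
  frame-closed x _ (_ , (refl ∷ refl ∷ refl ∷ refl ∷ []) , ())

  frame-independent : ∀ S → S ⊆ F → S ≢ [] → sumV (map lift S) ≢ 0v
  frame-independent _ (_ ∷ʳ _ ∷ʳ _ ∷ʳ _ ∷ʳ []) S≢[] _ = S≢[] refl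
  frame-independent _ (refl ∷ refl ∷ _ ∷ʳ _ ∷ʳ []) _ e = a≢b (sumV-pair≡0⇒≡ (∷-injectiveʳ e))
  frame-independent _ (refl ∷ _ ∷ʳ refl ∷ _ ∷ʳ []) _ e = a≢c (sumV-pair≡0⇒≡ (∷-injectiveʳ e))
  frame-independent _ (refl ∷ _ ∷ʳ _ ∷ʳ refl ∷ []) _ e = a≢d (sumV-pair≡0⇒≡ (∷-injectiveʳ e))
  frame-independent _ (_ ∷ʳ refl ∷ refl ∷ _ ∷ʳ []) _ e = b≢c (sumV-pair≡0⇒≡ (∷-injectiveʳ e))
  frame-independent _ (_ ∷ʳ refl ∷ _ ∷ʳ refl ∷ []) _ e = b≢d (sumV-pair≡0⇒≡ (∷-injectiveʳ e))
  frame-independent _ (_ ∷ʳ _ ∷ʳ refl ∷ refl ∷ []) _ e = c≢d (sumV-pair≡0⇒≡ (∷-injectiveʳ e))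
  frame-independent _ (refl ∷ refl ∷ refl ∷ refl ∷ []) _ e = sum₄≢0 (∷-injectiveʳ e)
  frame-independent _ (refl ∷ _ ∷ʳ _ ∷ʳ _ ∷ʳ []) _ ()
  frame-independent _ (_ ∷ʳ refl ∷ _ ∷ʳ _ ∷ʳ []) _ ()
  frame-independent _ (_ ∷ʳ _ ∷ʳ refl ∷ _ ∷ʳ []) _ ()
  frame-independent _ (_ ∷ʳ _ ∷ʳ _ ∷ʳ refl ∷ []) _ ()
  frame-independent _ (_ ∷ʳ refl ∷ refl ∷ refl ∷ []) _ ()
  frame-independent _ (refl ∷ _ ∷ʳ refl ∷ refl ∷ []) _ ()
  frame-independent _ (refl ∷ refl ∷ _ ∷ʳ refl ∷ []) _ ()
  frame-independent _ (refl ∷ refl ∷ refl ∷ _ ∷ʳ []) _ ()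

  frame⇒containsU44 : ContainsU44Induced G
  frame⇒containsU44 =
    F , (a∈G ∷ b∈G ∷ c∈G ∷ d∈G ∷ [] , frame-closed) ,
    refl , distinct ,
    λ S S⊆F → AllPairs-resp-⊆ S⊆F distinct , λ S′ S′⊆S → frame-independent S′ (⊆-trans S′⊆S S⊆F)
    where
    distinct : Unique F
    distinct = (a≢b ∷ a≢c ∷ a≢d ∷ []) ∷ (b≢c ∷ b≢d ∷ []) ∷ (c≢d ∷ []) ∷ [] ∷ []

∉-quad : ∀ {A : Set} {x a b c d : A} → x ≢ a → x ≢ b → x ≢ c → x ≢ d → x ∉ a ∷ b ∷ c ∷ d ∷ []
∉-quad x≢a _ _ _ (here x≡a) = x≢a x≡a
∉-quad _ x≢b _ _ (there (here x≡b)) = x≢b x≡b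
∉-quad _ _ x≢c _ (there (there (here x≡c))) = x≢c x≡c
∉-quad _ _ _ x≢d (there (there (there (here x≡d)))) = x≢d x≡d

module _ {m} {x y z : Vec Bool m} where
  private
    ρ : Vec (Vec Bool m) 3
    ρ = x ∷ y ∷ z ∷ []

  sum₃≢₁ : y ≢ z → sum₃ x y z ≢ x
  sum₃≢₁ y≢z e = y≢z (⊕≡0⇒≡ (trans (solve (x₁ :∙ x₂) (:sum₃ x₀ x₁ x₂ :∙ x₀) refl ρ) (≡⇒⊕≡0 e)))

  sum₃≢₂ : x ≢ z → sum₃ x y z ≢ y
  sum₃≢₂ x≢z e = x≢z (⊕≡0⇒≡ (trans (solve (x₀ :∙ x₂) (:sum₃ x₀ x₁ x₂ :∙ x₁) refl ρ) (≡⇒⊕≡0 e)))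

  sum₃≢₃ : x ≢ y → sum₃ x y z ≢ z
  sum₃≢₃ x≢y e = x≢y (⊕≡0⇒≡ (trans (solve (x₀ :∙ x₁) (:sum₃ x₀ x₁ x₂ :∙ x₂) refl ρ) (≡⇒⊕≡0 e)))

module _ {m} {w x y z : Vec Bool m} where
  private
    sum₄≡sum₃⊕ : sum₄ w x y z ≡ sum₃ w x y ⊕ z
    sum₄≡sum₃⊕ = solve (:sum₄ x₀ x₁ x₂ x₃) (:sum₃ x₀ x₁ x₂ :∙ x₃) refl (w ∷ x ∷ y ∷ z ∷ [])

  sum₃≡⇒sum₄≡0 : sum₃ w x y ≡ z → sum₄ w x y z ≡ 0v
  sum₃≡⇒sum₄≡0 e = trans sum₄≡sum₃⊕ (≡⇒⊕≡0 e)

  sum₄≡0⇒sum₃≡ : sum₄ w x y z ≡ 0v → sum₃ w x y ≡ z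
  sum₄≡0⇒sum₃≡ e = ⊕≡0⇒≡ (trans (sym sum₄≡sum₃⊕) e)

containsU44⇒frame : ∀ {n} {G : Subset n} → ContainsU44Induced G → ∃[ a ] ∃[ b ] ∃[ c ] ∃[ d ] Frame G a b c d
containsU44⇒frame ([] , _ , () , _)
containsU44⇒frame (_ ∷ [] , _ , () , _)
containsU44⇒frame (_ ∷ _ ∷ [] , _ , () , _)
containsU44⇒frame (_ ∷ _ ∷ _ ∷ [] , _ , () , _)
containsU44⇒frame (_ ∷ _ ∷ _ ∷ _ ∷ _ ∷ _ , _ , () , _)
containsU44⇒frame {G = G} (F@(a ∷ b ∷ c ∷ d ∷ []) , (a∈G ∷ b∈G ∷ c∈G ∷ d∈G ∷ [] , closed) , _ , distinct , indep)
  with (a≢b ∷ a≢c ∷ a≢d ∷ []) ∷ (b≢c ∷ b≢d ∷ []) ∷ (c≢d ∷ []) ∷ [] ∷ [] ← distinct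
  = a , b , c , d , record
  { a∈G = a∈G ; b∈G = b∈G ; c∈G = c∈G ; d∈G = d∈G
  ; bcd∉G = red (b ∷ c ∷ d ∷ [] , a ∷ʳ refl ∷ refl ∷ refl ∷ [] , refl) (∉-quad bcd≢a (sum₃≢₁ c≢d) (sum₃≢₂ b≢d) (sum₃≢₃ b≢c))
  ; acd∉G = red (a ∷ c ∷ d ∷ [] , refl ∷ b ∷ʳ refl ∷ refl ∷ [] , refl) (∉-quad (sum₃≢₁ c≢d) acd≢b (sum₃≢₂ a≢d) (sum₃≢₃ a≢c))
  ; abd∉G = red (a ∷ b ∷ d ∷ [] , refl ∷ refl ∷ c ∷ʳ refl ∷ [] , refl) (∉-quad (sum₃≢₁ b≢d) (sum₃≢₂ a≢d) abd≢c (sum₃≢₃ a≢b))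
  ; abc∉G = red (a ∷ b ∷ c ∷ [] , refl ∷ refl ∷ refl ∷ d ∷ʳ [] , refl) (∉-quad (sum₃≢₁ b≢c) (sum₃≢₂ a≢c) (sum₃≢₃ a≢b) abc≢d)
  ; a≢b = a≢b ; a≢c = a≢c ; a≢d = a≢d ; b≢c = b≢c ; b≢d = b≢d ; c≢d = c≢d
  ; sum₄≢0 = sum₄≢0
  }
  where
  ρ : Vec (Point _) 4
  ρ = a ∷ b ∷ c ∷ d ∷ []

  sum₄≢0 : sum₄ a b c d ≢ 0v
  sum₄≢0 e = proj₂ (indep F ⊆-refl) F ⊆-refl (λ ()) (cong (false ∷_) e)

  viaSum₄ : ∀ {t u} → sum₄ a b c d ≡ t ⊕ u → t ≢ u
  viaSum₄ eq t≡u = sum₄≢0 (trans eq (≡⇒⊕≡0 t≡u))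

  bcd≢a : sum₃ b c d ≢ a
  bcd≢a = viaSum₄ (solve (:sum₄ x₀ x₁ x₂ x₃) (:sum₃ x₁ x₂ x₃ :∙ x₀) refl ρ)
  acd≢b : sum₃ a c d ≢ b
  acd≢b = viaSum₄ (solve (:sum₄ x₀ x₁ x₂ x₃) (:sum₃ x₀ x₂ x₃ :∙ x₁) refl ρ)
  abd≢c : sum₃ a b d ≢ c
  abd≢c = viaSum₄ (solve (:sum₄ x₀ x₁ x₂ x₃) (:sum₃ x₀ x₁ x₃ :∙ x₂) refl ρ)
  abc≢d : sum₃ a b c ≢ d
  abc≢d = contraposition sum₃≡⇒sum₄≡0 sum₄≢0

  red : ∀ {x} → InSpan F x → x ∉ F → G x ≡ false
  red {x} span x∉F = ¬-not (λ x∈G → x∉F (closed x x∈G span))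

-- Affine flats

every-or-counterexample : ∀ {n} {P : Point n → Set} → (∀ x → Dec (P x)) → (∀ x → P x) ⊎ ∃[ x ] ¬ P x
every-or-counterexample {zero} P? with P? []
... | yes p = inj₁ λ { [] → p }
... | no ¬p = inj₂ ([] , ¬p)
every-or-counterexample {suc n} P?
  with every-or-counterexample (λ x → P? (false ∷ x)) | every-or-counterexample (λ x → P? (true ∷ x))
... | inj₁ all₀ | inj₁ all₁ = inj₁ λ { (false ∷ x) → all₀ x ; (true ∷ x) → all₁ x }
... | inj₂ (x , ¬p) | _ = inj₂ (false ∷ x , ¬p)
... | inj₁ _ | inj₂ (x , ¬p) = inj₂ (true ∷ x , ¬p)

TripleClosed : ∀ {n} → Subset n → Set
TripleClosed F = ∀ {x y z} → F x ≡ true → F y ≡ true → F z ≡ true → F (sum₃ x y z) ≡ true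

affineFlat⇒tripleClosed : ∀ {n} {F : Subset n} → IsAffineFlat F → TripleClosed F
affineFlat⇒tripleClosed (inj₁ empty) {x} x∈F with () ← trans (sym x∈F) (empty x)
affineFlat⇒tripleClosed {F = F} (inj₂ (v , _ , W-closed)) {x} {y} {z} x∈F y∈F z∈F =
  subst (λ u → F u ≡ true) (solve ((x₀ :∙ x₃) :∙ (x₁ :∙ x₃) :∙ (x₂ :∙ x₃) :∙ x₃) (:sum₃ x₀ x₁ x₂) refl (x ∷ y ∷ z ∷ v ∷ []))
    (W-closed _ (z ⊕ v) (W-closed (x ⊕ v) (y ⊕ v) (shift x∈F) (shift y∈F)) (shift z∈F))
  where
  shift : ∀ {u} → F u ≡ true → F (u ⊕ v ⊕ v) ≡ true
  shift {u} = subst (λ w → F w ≡ true) (solve x₀ (x₀ :∙ x₁ :∙ x₁) refl (u ∷ v ∷ []))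

tripleClosed⇒affineFlat : ∀ {n} {F : Subset n} → TripleClosed F → IsAffineFlat F
tripleClosed⇒affineFlat {F = F} closed with every-or-counterexample (λ x → F x ≟ᵇ false)
... | inj₁ empty = inj₁ empty
... | inj₂ (u , u∉F) = inj₂ (u , subst (λ w → F w ≡ true) (sym (⊕-identityˡ u)) (¬-not u∉F) , W-closed)
  where
  W-closed : ∀ x y → F (x ⊕ u) ≡ true → F (y ⊕ u) ≡ true → F (x ⊕ y ⊕ u) ≡ true
  W-closed x y x+u∈F y+u∈F =
    subst (λ w → F w ≡ true) (solve (:sum₃ (x₀ :∙ x₂) (x₁ :∙ x₂) x₂) (x₀ :∙ x₁ :∙ x₂) refl (x ∷ y ∷ u ∷ []))
      (closed x+u∈F y+u∈F (¬-not u∉F))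

_∩_ : ∀ {n} → Subset n → Subset n → Subset n
(F ∩ H) x = F x ∧ H x

∧≡true⇒ : ∀ {a b : Bool} → a ∧ b ≡ true → a ≡ true × b ≡ true
∧≡true⇒ {true} {true} _ = refl , refl

∩-closed : ∀ {n} {F H : Subset n} → TripleClosed F → TripleClosed H → TripleClosed (F ∩ H)
∩-closed F-closed H-closed x∈ y∈ z∈
  with x∈F , x∈H ← ∧≡true⇒ x∈ | y∈F , y∈H ← ∧≡true⇒ y∈ | z∈F , z∈H ← ∧≡true⇒ z∈
  = cong₂ _∧_ (F-closed x∈F y∈F z∈F) (H-closed x∈H y∈H z∈H)

-- Inner products and hyperplanes

infix 7 _·_

_·_ : ∀ {n} → Vec Bool n → Vec Bool n → Bool
[] · [] = false
(a ∷ l) · (x ∷ y) = (a ∧ x) xor (l · y)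

·-0ʳ : ∀ {n} (l : Vec Bool n) → l · 0v ≡ false
·-0ʳ [] = refl
·-0ʳ (a ∷ l) = cong₂ _xor_ (∧-zeroʳ a) (·-0ʳ l)

·-0ˡ : ∀ {n} (x : Vec Bool n) → 0v · x ≡ false
·-0ˡ [] = refl
·-0ˡ (_ ∷ x) = ·-0ˡ x

·-⊕ʳ : ∀ {n} (l x y : Vec Bool n) → l · (x ⊕ y) ≡ l · x xor l · y
·-⊕ʳ [] [] [] = refl
·-⊕ʳ (a ∷ l) (b ∷ x) (c ∷ y) =
  trans (cong₂ _xor_ (∧-distribˡ-xor a b c) (·-⊕ʳ l x y)) (xor-interchange (a ∧ b) (a ∧ c) (l · x) (l · y))

·-sumV : ∀ {n} (l : Vec Bool n) (xs : List (Vec Bool n)) → l · sumV xs ≡ foldr _xor_ false (map (l ·_) xs)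
·-sumV l [] = ·-0ʳ l
·-sumV l (x ∷ xs) = trans (·-⊕ʳ l x (sumV xs)) (cong (l · x xor_) (·-sumV l xs))

·-pair : ∀ {n} (l : Vec Bool n) {x y a b} → l · x ≡ a → l · y ≡ b → l · (x ⊕ y) ≡ a xor b
·-pair l {x} {y} refl refl = ·-⊕ʳ l x y

·-triple : ∀ {n} (l : Vec Bool n) {x y z a b c} → l · x ≡ a → l · y ≡ b → l · z ≡ c →
           l · sum₃ x y z ≡ a xor (b xor (c xor false))
·-triple l {x} {y} {z} refl refl refl = ·-sumV l (x ∷ y ∷ z ∷ [])

·-shift : ∀ {n} (l : Vec Bool n) {x y z a b} → l · x ≡ a → l · y ≡ b → l · z ≡ b → l · (x ⊕ (y ⊕ z)) ≡ a
·-shift l {a = a} {b} l·x l·y l·z =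
  trans (·-pair l l·x (·-pair l l·y l·z)) (trans (cong (a xor_) (xor-same b)) (xor-identityʳ a))

·-separates : ∀ {n} (l : Vec Bool n) {x y} → l · x ≢ l · y → x ≢ y
·-separates l l·x≢l·y x≡y = l·x≢l·y (cong (l ·_) x≡y)

nonzero-witness : ∀ {n} (l : Vec Bool n) → l ≢ 0v → ∃[ u ] l · u ≡ true
nonzero-witness [] l≢0 = ⊥-elim (l≢0 refl)
nonzero-witness (true ∷ l) _ = true ∷ 0v , cong not (·-0ʳ l)
nonzero-witness (false ∷ l) l≢0 with u , l·u ← nonzero-witness l (l≢0 ∘ cong (false ∷_)) = false ∷ u , l·u

xor-self³ : ∀ b → b xor (b xor (b xor false)) ≡ b
xor-self³ false = refl
xor-self³ true = refl

hyperplane : ∀ {n} → Vec Bool n → Bool → Subset n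
hyperplane l e x = does (l · x ≟ᵇ e)

module _ {n} (l : Vec Bool n) (e : Bool) (x : Point n) where
  ∈-hyperplane : l · x ≡ e → hyperplane l e x ≡ true
  ∈-hyperplane = dec-true (l · x ≟ᵇ e)

  ∉-hyperplane : l · x ≢ e → hyperplane l e x ≡ false
  ∉-hyperplane = dec-false (l · x ≟ᵇ e)

  hyperplane⇒· : hyperplane l e x ≡ true → l · x ≡ e
  hyperplane⇒· x∈H with l · x ≟ᵇ e
  ... | yes l·x≡e = l·x≡e

hyperplane-closed : ∀ {n} (l : Vec Bool n) e → TripleClosed (hyperplane l e)
hyperplane-closed l e {x} {y} {z} x∈H y∈H z∈H =
  ∈-hyperplane l e (sum₃ x y z)
    (trans (·-triple l (hyperplane⇒· l e x x∈H) (hyperplane⇒· l e y y∈H) (hyperplane⇒· l e z z∈H)) (xor-self³ e))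

-- Chains of flats and affine targets

even : ℕ → Bool
even zero = true
even (suc i) = not (even i)

even-double : ∀ j → even (j + j) ≡ true
even-double zero = refl
even-double (suc j) rewrite +-suc j j = trans (not-involutive (even (j + j))) (even-double j)

Even⇒even : ∀ {i} → Even i → even i ≡ true
Even⇒even (j , refl) = even-double j

even⇒Even : ∀ i → even i ≡ true → Even i
even⇒Even zero _ = 0 , refl
even⇒Even (suc zero) ()
even⇒Even (suc (suc i)) e with j , refl ← even⇒Even i (trans (sym (not-involutive (even i))) e)
  = suc j , cong suc (sym (+-suc j j))

crossing : ∀ {P : ℕ → Set} → Decidable P → ¬ P 0 → ∀ {k} → P k → ∃[ i ] i < k × P (suc i) × ¬ P i
crossing P? ¬P₀ {zero} P₀ = ⊥-elim (¬P₀ P₀)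
crossing P? ¬P₀ {suc k} Pₖ₊₁ with P? k
... | no ¬Pₖ = k , n<1+n k , Pₖ₊₁ , ¬Pₖ
... | yes Pₖ with i , i<k , rest ← crossing P? ¬P₀ Pₖ = i , m<n⇒m<1+n i<k , rest

-- A nested sequence of flats from ∅ to T of which X is the affine target,
-- stated layer by layer.
record Chain {n} (T X : Subset n) : Set where
  field
    height : ℕ
    flat : ℕ → Subset n
    flat-closed : ∀ i → i ≤ height → TripleClosed (flat i)
    flat-bottom : ∀ x → flat 0 x ≡ false
    flat-nested : ∀ i x → i < height → flat i x ≡ true → flat (suc i) x ≡ true
    flat-top : ∀ x → flat height x ≡ T x
    layer-colour : ∀ i x → i < height → flat (suc i) x ≡ true → flat i x ≡ false → X x ≡ even i

module _ {n} {F : ℕ → Subset n} {k : ℕ} (nested : ∀ i x → i < k → F i x ≡ true → F (suc i) x ≡ true) where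

  nested-monotone : ∀ {i j x} → i ≤ j → j ≤ k → F i x ≡ true → F j x ≡ true
  nested-monotone {j = zero} z≤n _ x∈F = x∈F
  nested-monotone {i} {suc j} {x} i≤1+j 1+j≤k x∈F with m≤n⇒m<n∨m≡n i≤1+j
  ... | inj₁ (s≤s i≤j) = nested j x 1+j≤k (nested-monotone i≤j (<⇒≤ 1+j≤k) x∈F)
  ... | inj₂ refl = x∈F

  layer-unique : ∀ {i j x} → i < k → j < k → F (suc i) x ≡ true → F i x ≡ false → F (suc j) x ≡ true → F j x ≡ false → i ≡ j
  layer-unique {i} {j} i<k j<k x∈Fᵢ₊₁ x∉Fᵢ x∈Fⱼ₊₁ x∉Fⱼ with <-cmp i j
  ... | tri< i<j _ _ with () ← trans (sym (nested-monotone i<j (<⇒≤ j<k) x∈Fᵢ₊₁)) x∉Fⱼ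
  ... | tri≈ _ i≡j _ = i≡j
  ... | tri> _ _ j<i with () ← trans (sym (nested-monotone j<i (<⇒≤ i<k) x∈Fⱼ₊₁)) x∉Fᵢ

target⇒chain : ∀ {n} {X : Subset n} → IsAffineTarget X → Chain (λ _ → true) X
target⇒chain {X = X} (k , F , flat , bottom , nested , top , cover , back) = record
  { height = k ; flat = F
  ; flat-closed = λ i i≤k → affineFlat⇒tripleClosed (flat i (s≤s i≤k))
  ; flat-bottom = bottom ; flat-nested = nested ; flat-top = top
  ; layer-colour = colour
  }
  where
  colour : ∀ i x → i < k → F (suc i) x ≡ true → F i x ≡ false → X x ≡ even i
  colour i x i<k x∈Fᵢ₊₁ x∉Fᵢ with X x in Xx
  ... | true with j , j<k , Even-j , x∈Fⱼ₊₁ , x∉Fⱼ ← cover x Xx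
    rewrite layer-unique nested j<k i<k x∈Fⱼ₊₁ x∉Fⱼ x∈Fᵢ₊₁ x∉Fᵢ = sym (Even⇒even Even-j)
  ... | false = sym (¬-not λ even-i → not-¬ Xx (back x i i<k (even⇒Even i even-i) x∈Fᵢ₊₁ x∉Fᵢ))

chain⇒target : ∀ {n} {X : Subset n} → Chain (λ _ → true) X → IsAffineTarget X
chain⇒target {X = X} chain =
  height , flat , (λ i i<1+h → tripleClosed⇒affineFlat (flat-closed i (≤-pred i<1+h))) ,
  flat-bottom , flat-nested , flat-top , cover , back
  where
  open Chain chain
  cover : ∀ x → X x ≡ true → ∃[ i ] (i < height × Even i × flat (suc i) x ≡ true × flat i x ≡ false)
  cover x Xx with i , i<h , x∈Fᵢ₊₁ , x∉Fᵢ ← crossing (λ i → flat i x ≟ᵇ true) (λ x∈F₀ → not-¬ x∈F₀ (flat-bottom x)) (flat-top x)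
    = i , i<h , even⇒Even i (trans (sym (layer-colour i x i<h x∈Fᵢ₊₁ (¬-not x∉Fᵢ))) Xx) , x∈Fᵢ₊₁ , ¬-not x∉Fᵢ
  back : ∀ x i → i < height → Even i → flat (suc i) x ≡ true → flat i x ≡ false → X x ≡ true
  back x i i<h Even-i x∈Fᵢ₊₁ x∉Fᵢ = trans (layer-colour i x i<h x∈Fᵢ₊₁ x∉Fᵢ) (Even⇒even Even-i)

-- The first layer meeting the frame contains all four points of it and,
-- by triple closure, the four sums of three; the points of the colour
-- opposite to the layer's lie in the flat below, and hence so do all eight.
module _ {n} {X : Subset n} (chain : Chain (λ _ → true) X) where
  open Chain chain

  chain⇒frameFree : FrameFree X
  chain⇒frameFree {a} {b} {c} {d} frame
    with i , i<h , a∈Fᵢ₊₁ ∷ b∈Fᵢ₊₁ ∷ c∈Fᵢ₊₁ ∷ d∈Fᵢ₊₁ ∷ [] , frame⊈Fᵢ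
           ← crossing (λ i → all? (λ p → flat i p ≟ᵇ true) (a ∷ b ∷ c ∷ d ∷ []))
                      (λ { (a∈F₀ ∷ _) → not-¬ a∈F₀ (flat-bottom a) })
                      (flat-top a ∷ flat-top b ∷ flat-top c ∷ flat-top d ∷ [])
    = frame⊈Fᵢ (frame⊆Fᵢ (even i) refl)
    where
    open Frame frame

    below : ∀ {p} → flat (suc i) p ≡ true → X p ≢ even i → flat i p ≡ true
    below {p} p∈Fᵢ₊₁ wrong = ¬-not λ p∉Fᵢ → wrong (layer-colour i p i<h p∈Fᵢ₊₁ p∉Fᵢ)

    frame⊆Fᵢ : ∀ e → even i ≡ e → All (λ p → flat i p ≡ true) (a ∷ b ∷ c ∷ d ∷ [])
    frame⊆Fᵢ false eᵢ =
      below a∈Fᵢ₊₁ (green≢odd a∈G) ∷ below b∈Fᵢ₊₁ (green≢odd b∈G) ∷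
      below c∈Fᵢ₊₁ (green≢odd c∈G) ∷ below d∈Fᵢ₊₁ (green≢odd d∈G) ∷ []
      where
      green≢odd : ∀ {p} → X p ≡ true → X p ≢ even i
      green≢odd Xp e = not-¬ eᵢ (trans (sym e) Xp)
    frame⊆Fᵢ true eᵢ =
      recover (solve x₀ (:sum₃ (:sum₃ x₀ x₂ x₃) (:sum₃ x₀ x₁ x₃) (:sum₃ x₀ x₁ x₂)) refl ρ) acd abd abc ∷
      recover (solve x₁ (:sum₃ (:sum₃ x₁ x₂ x₃) (:sum₃ x₀ x₁ x₃) (:sum₃ x₀ x₁ x₂)) refl ρ) bcd abd abc ∷
      recover (solve x₂ (:sum₃ (:sum₃ x₁ x₂ x₃) (:sum₃ x₀ x₂ x₃) (:sum₃ x₀ x₁ x₂)) refl ρ) bcd acd abc ∷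
      recover (solve x₃ (:sum₃ (:sum₃ x₁ x₂ x₃) (:sum₃ x₀ x₂ x₃) (:sum₃ x₀ x₁ x₃)) refl ρ) bcd acd abd ∷ []
      where
      ρ : Vec (Point n) 4
      ρ = a ∷ b ∷ c ∷ d ∷ []
      closedᵢ₊₁ = flat-closed (suc i) i<h
      red≢even : ∀ {p} → X p ≡ false → X p ≢ even i
      red≢even Xp e = not-¬ eᵢ (trans (sym e) Xp)
      bcd = below (closedᵢ₊₁ b∈Fᵢ₊₁ c∈Fᵢ₊₁ d∈Fᵢ₊₁) (red≢even bcd∉G)
      acd = below (closedᵢ₊₁ a∈Fᵢ₊₁ c∈Fᵢ₊₁ d∈Fᵢ₊₁) (red≢even acd∉G)
      abd = below (closedᵢ₊₁ a∈Fᵢ₊₁ b∈Fᵢ₊₁ d∈Fᵢ₊₁) (red≢even abd∉G)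
      abc = below (closedᵢ₊₁ a∈Fᵢ₊₁ b∈Fᵢ₊₁ c∈Fᵢ₊₁) (red≢even abc∉G)
      recover : ∀ {p q r s} → p ≡ sum₃ q r s → flat i q ≡ true → flat i r ≡ true → flat i s ≡ true → flat i p ≡ true
      recover refl q∈Fᵢ r∈Fᵢ s∈Fᵢ = flat-closed i (<⇒≤ i<h) q∈Fᵢ r∈Fᵢ s∈Fᵢ

emptyChain : ∀ {n} {X : Subset n} → Chain (λ _ → false) X
emptyChain = record
  { height = 0 ; flat = λ _ _ → false
  ; flat-closed = λ _ _ () ; flat-bottom = λ _ → refl ; flat-nested = λ _ _ ()
  ; flat-top = λ _ → refl ; layer-colour = λ _ _ ()
  }

module _ {n} {T′ X′ : Subset n} (chain : Chain T′ X′) where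
  open Chain chain

  chain-top-closed : TripleClosed T′
  chain-top-closed {x} {y} {z} x∈T′ y∈T′ z∈T′ =
    trans (sym (flat-top _)) (flat-closed height ≤-refl (up x∈T′) (up y∈T′) (up z∈T′))
    where
    up : ∀ {p} → T′ p ≡ true → flat height p ≡ true
    up {p} p∈T′ = trans (flat-top p) p∈T′

  snoc : ∀ {T X : Subset n} → TripleClosed T → (∀ x → T′ x ≡ true → T x ≡ true) →
         (∀ x → T′ x ≡ true → X x ≡ X′ x) → (∀ x → T x ≡ true → T′ x ≡ false → X x ≡ even height) →
         Chain T X
  snoc {T} {X} T-closed T′⊆T agree top-colour = record
    { height = suc height ; flat = flat′
    ; flat-closed = closed′ ; flat-bottom = λ x → trans (cong (λ F → F x) (flat′-below z≤n)) (flat-bottom x)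
    ; flat-nested = nested′ ; flat-top = λ x → cong (λ F → F x) flat′-top ; layer-colour = colour′
    }
    where
    flat′ : ℕ → Subset n
    flat′ i = if does (i ≤? height) then flat i else T

    flat′-below : ∀ {i} → i ≤ height → flat′ i ≡ flat i
    flat′-below {i} i≤h = cong (λ b → if b then flat i else T) (dec-true (_ ≤? height) i≤h)

    flat′-top : flat′ (suc height) ≡ T
    flat′-top = cong (λ b → if b then flat (suc height) else T) (dec-false (suc height ≤? height) (<-irrefl refl))

    closed′ : ∀ i → i ≤ suc height → TripleClosed (flat′ i)
    closed′ i i≤1+h with m≤n⇒m<n∨m≡n i≤1+h
    ... | inj₁ i<1+h rewrite flat′-below (≤-pred i<1+h) = flat-closed i (≤-pred i<1+h)
    ... | inj₂ refl rewrite flat′-top = T-closed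

    nested′ : ∀ i x → i < suc height → flat′ i x ≡ true → flat′ (suc i) x ≡ true
    nested′ i x i<1+h x∈ with m≤n⇒m<n∨m≡n (≤-pred i<1+h)
    ... | inj₁ i<h rewrite flat′-below (<⇒≤ i<h) | flat′-below i<h = flat-nested i x i<h x∈
    ... | inj₂ refl rewrite flat′-below (≤-refl {height}) | flat′-top = T′⊆T x (trans (sym (flat-top x)) x∈)

    colour′ : ∀ i x → i < suc height → flat′ (suc i) x ≡ true → flat′ i x ≡ false → X x ≡ even i
    colour′ i x i<1+h x∈ x∉ with m≤n⇒m<n∨m≡n (≤-pred i<1+h)
    ... | inj₁ i<h rewrite flat′-below (<⇒≤ i<h) | flat′-below i<h =
      trans (agree x (trans (sym (flat-top x)) (nested-monotone flat-nested i<h ≤-refl x∈))) (layer-colour i x i<h x∈ x∉)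
    ... | inj₂ refl rewrite flat′-below (≤-refl {height}) | flat′-top =
      top-colour x x∈ (trans (sym (flat-top x)) x∉)

-- If the parity is wrong, an empty layer goes in first.
extend : ∀ {n} {T′ X′ T X : Subset n} → Chain T′ X′ → TripleClosed T → (∀ x → T′ x ≡ true → T x ≡ true) →
         (∀ x → T′ x ≡ true → X x ≡ X′ x) → ∀ c → (∀ x → T x ≡ true → T′ x ≡ false → X x ≡ c) →
         Chain T X
extend chain T-closed T′⊆T agree c top-colour with c ≟ᵇ even (Chain.height chain)
... | yes refl = snoc chain T-closed T′⊆T agree top-colour
... | no c≢even = snoc padded T-closed T′⊆T agree (λ x x∈T x∉T′ → trans (top-colour x x∈T x∉T′) (¬-not c≢even))
  where
  padded = snoc chain (chain-top-closed chain) (λ _ x∈ → x∈) (λ _ _ → refl) (λ x x∈ x∉ → ⊥-elim (not-¬ x∈ x∉))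

chain-resp : ∀ {n} {T X Y : Subset n} → (∀ x → X x ≡ Y x) → Chain T X → Chain T Y
chain-resp X≡Y chain = record
  { height = height ; flat = flat ; flat-closed = flat-closed ; flat-bottom = flat-bottom
  ; flat-nested = flat-nested ; flat-top = flat-top
  ; layer-colour = λ i x i<h x∈ x∉ → trans (sym (X≡Y x)) (layer-colour i x i<h x∈ x∉)
  }
  where open Chain chain

-- An entry (l , e , c) stands for the hyperplane l · x ≡ e with colour c.
DecisionList : ℕ → Set
DecisionList n = List (Vec Bool n × Bool × Bool)

decide : ∀ {n} → DecisionList n → Bool → Subset n
decide [] c₀ x = c₀
decide ((l , e , c) ∷ L) c₀ x = if hyperplane l e x then c else decide L c₀ x

decisionList⇒chain : ∀ {n} {T : Subset n} → TripleClosed T → ∀ L c₀ → Chain T (decide L c₀)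
decisionList⇒chain T-closed [] c₀ = extend (emptyChain {X = λ _ → c₀}) T-closed (λ _ ()) (λ _ ()) c₀ (λ _ _ _ → refl)
decisionList⇒chain {T = T} T-closed ((l , e , c) ∷ L) c₀ =
  extend (decisionList⇒chain {T = T ∩ hyperplane l (not e)} (∩-closed {F = T} T-closed (hyperplane-closed l (not e))) L c₀)
         T-closed (λ x x∈ → proj₁ (∧≡true⇒ x∈)) agree c colour
  where
  agree : ∀ x → (T ∩ hyperplane l (not e)) x ≡ true → decide ((l , e , c) ∷ L) c₀ x ≡ decide L c₀ x
  agree x x∈ = cong (λ b → if b then c else decide L c₀ x)
    (∉-hyperplane l e x λ l·x≡e → not-¬ refl (trans (sym l·x≡e) (hyperplane⇒· l (not e) x (proj₂ (∧≡true⇒ x∈)))))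

  colour : ∀ x → T x ≡ true → (T ∩ hyperplane l (not e)) x ≡ false → decide ((l , e , c) ∷ L) c₀ x ≡ c
  colour x x∈T x∉ = cong (λ b → if b then c else decide L c₀ x) (∈-hyperplane l e x l·x≡e)
    where
    l·x≡e : l · x ≡ e
    l·x≡e = trans (¬-not λ l·x≡¬e → not-¬ (cong₂ _∧_ x∈T (∈-hyperplane l (not e) x l·x≡¬e)) x∉) (not-involutive e)

-- Monochromatic hyperplanes

frameFree-pullback : ∀ {m n} {f : Subset n} (ψ : Point m → Point n) →
                     (∀ a b c → ψ (sum₃ a b c) ≡ sum₃ (ψ a) (ψ b) (ψ c)) → Injective _≡_ _≡_ ψ →
                     FrameFree f → FrameFree (f ∘ ψ)
frameFree-pullback {f = f} ψ ψ-affine ψ-injective frameFree {a} {b} {c} {d} frame = frameFree record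
  { a∈G = a∈G ; b∈G = b∈G ; c∈G = c∈G ; d∈G = d∈G
  ; bcd∉G = red bcd∉G (ψ-affine b c d) ; acd∉G = red acd∉G (ψ-affine a c d)
  ; abd∉G = red abd∉G (ψ-affine a b d) ; abc∉G = red abc∉G (ψ-affine a b c)
  ; a≢b = a≢b ∘ ψ-injective ; a≢c = a≢c ∘ ψ-injective ; a≢d = a≢d ∘ ψ-injective
  ; b≢c = b≢c ∘ ψ-injective ; b≢d = b≢d ∘ ψ-injective ; c≢d = c≢d ∘ ψ-injective
  ; sum₄≢0 = λ ψsum≡0 → sum₄≢0 (sum₃≡⇒sum₄≡0 (ψ-injective (trans (ψ-affine a b c) (sum₄≡0⇒sum₃≡ ψsum≡0))))
  }
  where
  open Frame frame
  red : ∀ {p q} → f (ψ p) ≡ false → ψ p ≡ q → f q ≡ false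
  red fψp refl = fψp

slice : ∀ {n} → Bool → Subset (suc n) → Subset n
slice β f y = f (β ∷ y)

frameFree-slice : ∀ {n} {f : Subset (suc n)} β → FrameFree f → FrameFree (slice β f)
frameFree-slice β = frameFree-pullback (β ∷_) (λ a b c → cong (_∷ sum₃ a b c) (sym (xor-self³ β))) ∷-injectiveʳ

ConstantOn : ∀ {n} → Subset n → Vec Bool n → Bool → Bool → Set
ConstantOn g l t c = ∀ y → l · y ≡ t → g y ≡ c

record MonochromaticHyperplane {n} (f : Subset n) : Set where
  field
    normal : Vec Bool n
    offset : Bool
    colour : Bool
    normal≢0 : normal ≢ 0v
    constant : ConstantOn f normal offset colour

constant-slice⇒monochromatic : ∀ {n} {f : Subset (suc n)} β c → (∀ y → slice β f y ≡ c) → MonochromaticHyperplane f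
constant-slice⇒monochromatic {f = f} β c constant = record
  { normal = true ∷ 0v ; offset = β ; colour = c ; normal≢0 = λ () ; constant = on-slice }
  where
  on-slice : ConstantOn f (true ∷ 0v) β c
  on-slice (x ∷ y) x≡β rewrite ·-0ˡ y | xor-identityʳ x | x≡β = constant y

glue : ∀ {n} {f : Subset (suc n)} (l : Vec Bool n) → l ≢ 0v → ∀ t₀ t₁ c →
       ConstantOn (slice false f) l t₀ c → ConstantOn (slice true f) l t₁ c → MonochromaticHyperplane f
glue {f = f} l l≢0 t₀ t₁ c constant₀ constant₁ = record
  { normal = (t₀ xor t₁) ∷ l ; offset = t₀ ; colour = c ; normal≢0 = l≢0 ∘ ∷-injectiveʳ ; constant = on-span }
  where
  offset-in-slice₁ : ∀ b → (t₀ xor t₁) xor b ≡ t₀ → b ≡ t₁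
  offset-in-slice₁ b e = begin
    b                                    ≡⟨ solveᵇ b₂ (b₀ :xor b₁ :xor b₂ :xor (b₀ :xor b₁)) refl (t₀ ∷ t₁ ∷ b ∷ []) ⟩
    ((t₀ xor t₁) xor b) xor (t₀ xor t₁)  ≡⟨ cong (_xor (t₀ xor t₁)) e ⟩
    t₀ xor (t₀ xor t₁)                   ≡⟨ solveᵇ (b₀ :xor (b₀ :xor b₁)) b₁ refl (t₀ ∷ t₁ ∷ []) ⟩
    t₁                                   ∎
    where open ≡-Reasoning
  on-span : ConstantOn f ((t₀ xor t₁) ∷ l) t₀ c
  on-span (false ∷ y) e rewrite ∧-zeroʳ (t₀ xor t₁) = constant₀ y e
  on-span (true ∷ y) e rewrite ∧-identityʳ (t₀ xor t₁) = constant₁ y (offset-in-slice₁ (l · y) e)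

constant-or-witness : ∀ {n} {P : Point n → Set} → (∀ y → Dec (P y)) → ∀ (g : Subset n) c →
                      (∀ y → P y → g y ≡ c) ⊎ ∃[ y ] (P y × g y ≡ not c)
constant-or-witness P? g c with every-or-counterexample (λ y → P? y →-dec g y ≟ᵇ c)
... | inj₁ constant = inj₁ constant
... | inj₂ (y , ¬constant) with P? y
...   | yes p = inj₂ (y , p , ¬-not λ gy≡c → ¬constant λ _ → gy≡c)
...   | no ¬p = ⊥-elim (¬constant λ p → contradiction p ¬p)

orient : ∀ {n} (g : Subset n) {P : Point n → Set} {x y} → P x → P y → g x ≢ g y →
         ∃[ p ] ∃[ q ] (P p × P q × g p ≡ true × g q ≡ false × p ⊕ q ≡ x ⊕ y)
orient g {x = x} {y} Px Py gx≢gy with g x in gx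
... | true = x , y , Px , Py , gx , ¬-not (gx≢gy ∘ sym) , refl
... | false = y , x , Py , Px , ¬-not (gx≢gy ∘ sym) , gx , ⊕-comm y x

not-xor-true : ∀ t → not t xor true ≡ t
not-xor-true false = refl
not-xor-true true = refl

xor-not-not : ∀ t₀ t₁ → t₀ xor (not t₀ xor (not t₁ xor false)) ≡ t₁
xor-not-not false false = refl
xor-not-not false true = refl
xor-not-not true false = refl
xor-not-not true true = refl

module _ {n} {f : Subset (suc n)} (frameFree : FrameFree f) {l : Vec Bool n} (l≢0 : l ≢ 0v) {t₀ t₁ c : Bool}
         (constant₀ : ConstantOn (slice false f) l t₀ c) (constant₁ : ConstantOn (slice true f) l t₁ (not c)) where

  -- With w = β ⊕ β′ = δ ⊕ δ′ and a₀ = β ⊕ u on the hyperplane of slice 0, a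
  -- frame is (0,a₀), (0,a₀+w), (0,β), (1,δ) if c is green and (0,β), (1,γ),
  -- (1,γ+w), (1,δ) with γ = a₀ + β + δ if c is red.
  parallel-frame : ∀ {u β β′ δ δ′} → l · u ≡ true →
                   l · β ≡ not t₀ → l · β′ ≡ not t₀ → l · δ ≡ not t₁ → l · δ′ ≡ not t₁ →
                   f (false ∷ β) ≡ true → f (false ∷ β′) ≡ false → f (true ∷ δ) ≡ true → f (true ∷ δ′) ≡ false →
                   β ⊕ β′ ≡ δ ⊕ δ′ → ⊥
  parallel-frame {u} {β} {β′} {δ} {δ′} l·u l·β l·β′ l·δ l·δ′ β∈f β′∉f δ∈f δ′∉f w≡δ⊕δ′ = frame c refl
    where
    w = β ⊕ β′
    a₀ = β ⊕ u
    γ = sum₃ a₀ β δ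
    ρ : Vec (Point n) 4
    ρ = u ∷ β ∷ β′ ∷ δ ∷ []
    :a₀ :w :γ : ⊕-Solver.Expr {n} 4
    :a₀ = x₁ :∙ x₀
    :w = x₁ :∙ x₂
    :γ = :sum₃ :a₀ x₁ x₃

    l·w : l · w ≡ false
    l·w = trans (·-pair l l·β l·β′) (xor-same (not t₀))
    w≢0 : w ≢ 0v
    w≢0 w≡0 = not-¬ β∈f (trans (cong (λ y → f (false ∷ y)) (⊕≡0⇒≡ w≡0)) β′∉f)
    l·a₀ : l · a₀ ≡ t₀
    l·a₀ = trans (·-pair l l·β l·u) (not-xor-true t₀)
    l·a₀⊕w : l · (a₀ ⊕ w) ≡ t₀
    l·a₀⊕w = trans (·-pair l l·a₀ l·w) (xor-identityʳ t₀)
    l·γ : l · γ ≡ t₁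
    l·γ = trans (·-triple l l·a₀ l·β l·δ) (xor-not-not t₀ t₁)
    l·γ⊕w : l · (γ ⊕ w) ≡ t₁
    l·γ⊕w = trans (·-pair l l·γ l·w) (xor-identityʳ t₁)
    δ′≡ : ∀ {p} → p ≡ w ⊕ δ → p ≡ δ′
    δ′≡ p≡ = trans p≡ (trans (cong (_⊕ δ) w≡δ⊕δ′) (solve (x₀ :∙ x₁ :∙ x₀) x₁ refl (δ ∷ δ′ ∷ [])))
    red₀ : ∀ {p q} → p ≡ q → f (false ∷ q) ≡ false → f (false ∷ p) ≡ false
    red₀ refl q∉f = q∉f
    red₁ : ∀ {p q} → p ≡ q → f (true ∷ q) ≡ false → f (true ∷ p) ≡ false
    red₁ refl q∉f = q∉f

    frame : ∀ c′ → c ≡ c′ → ⊥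
    frame true refl = frameFree {false ∷ a₀} {false ∷ (a₀ ⊕ w)} {false ∷ β} {true ∷ δ} record
      { a∈G = constant₀ a₀ l·a₀ ; b∈G = constant₀ (a₀ ⊕ w) l·a₀⊕w ; c∈G = β∈f ; d∈G = δ∈f
      ; abc∉G = red₀ (solve (:sum₃ :a₀ (:a₀ :∙ :w) x₁) x₂ refl ρ) β′∉f
      ; abd∉G = red₁ (δ′≡ (solve (:sum₃ :a₀ (:a₀ :∙ :w) x₃) (:w :∙ x₃) refl ρ)) δ′∉f
      ; acd∉G = constant₁ γ l·γ
      ; bcd∉G = constant₁ (sum₃ (a₀ ⊕ w) β δ) (trans (·-triple l l·a₀⊕w l·β l·δ) (xor-not-not t₀ t₁))
      ; a≢b = λ e → w≢0 (x≡x⊕y⇒y≡0 (∷-injectiveʳ e))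
      ; a≢c = λ e → ·-separates l (λ e′ → not-¬ refl (trans (sym l·a₀) (trans e′ l·β))) (∷-injectiveʳ e)
      ; a≢d = λ () ; b≢d = λ () ; c≢d = λ ()
      ; b≢c = λ e → ·-separates l (λ e′ → not-¬ refl (trans (sym l·a₀⊕w) (trans e′ l·β))) (∷-injectiveʳ e)
      ; sum₄≢0 = λ () }
    frame false refl = frameFree {false ∷ β} {true ∷ γ} {true ∷ (γ ⊕ w)} {true ∷ δ} record
      { a∈G = β∈f ; b∈G = constant₁ γ l·γ ; c∈G = constant₁ (γ ⊕ w) l·γ⊕w ; d∈G = δ∈f
      ; abc∉G = red₀ (solve (:sum₃ x₁ :γ (:γ :∙ :w)) x₂ refl ρ) β′∉f
      ; abd∉G = red₀ (solve (:sum₃ x₁ :γ x₃) :a₀ refl ρ) (constant₀ a₀ l·a₀)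
      ; acd∉G = red₀ (solve (:sum₃ x₁ (:γ :∙ :w) x₃) (:a₀ :∙ :w) refl ρ) (constant₀ (a₀ ⊕ w) l·a₀⊕w)
      ; bcd∉G = red₁ (δ′≡ (solve (:sum₃ :γ (:γ :∙ :w) x₃) (:w :∙ x₃) refl ρ)) δ′∉f
      ; a≢b = λ () ; a≢c = λ () ; a≢d = λ ()
      ; b≢c = λ e → w≢0 (x≡x⊕y⇒y≡0 (∷-injectiveʳ e))
      ; b≢d = λ e → ·-separates l (λ e′ → not-¬ refl (trans (sym l·γ) (trans e′ l·δ))) (∷-injectiveʳ e)
      ; c≢d = λ e → ·-separates l (λ e′ → not-¬ refl (trans (sym l·γ⊕w) (trans e′ l·δ))) (∷-injectiveʳ e)
      ; sum₄≢0 = λ () }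

  aligned : ∀ {b b′ d d′} → l · b ≡ not t₀ → l · b′ ≡ not t₀ → l · d ≡ not t₁ → l · d′ ≡ not t₁ →
            f (false ∷ b) ≢ f (false ∷ b′) → f (true ∷ d) ≢ f (true ∷ d′) → b ⊕ b′ ≡ d ⊕ d′ → ⊥
  aligned l·b l·b′ l·d l·d′ b≁b′ d≁d′ sums
    with β , β′ , l·β , l·β′ , β∈f , β′∉f , β⊕β′ ← orient (slice false f) l·b l·b′ b≁b′
       | δ , δ′ , l·δ , l·δ′ , δ∈f , δ′∉f , δ⊕δ′ ← orient (slice true f) l·d l·d′ d≁d′
       | u , l·u ← nonzero-witness l l≢0
    = parallel-frame l·u l·β l·β′ l·δ l·δ′ β∈f β′∉f δ∈f δ′∉f (trans β⊕β′ (trans sums (sym δ⊕δ′)))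

  -- Making the two differences equal: either b ⊕ d ⊕ d′ or d ⊕ b ⊕ b′ can
  -- replace one point of its pair, or both can be used together.
  bichromatic⇒⊥ : ∀ {b b′ d d′} →
                  l · b ≡ not t₀ → l · b′ ≡ not t₀ → l · d ≡ not t₁ → l · d′ ≡ not t₁ →
                  f (false ∷ b) ≢ f (false ∷ b′) → f (true ∷ d) ≢ f (true ∷ d′) → ⊥
  bichromatic⇒⊥ {b} {b′} {d} {d′} l·b l·b′ l·d l·d′ b≁b′ d≁d′
    with f (false ∷ (b ⊕ (d ⊕ d′))) ≟ᵇ f (false ∷ b) | f (true ∷ (d ⊕ (b ⊕ b′))) ≟ᵇ f (true ∷ d)
  ... | no b″≁b | _ = aligned l·b (·-shift l l·b l·d l·d′) l·d l·d′ (b″≁b ∘ sym) d≁d′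
                        (solve (x₀ :∙ (x₀ :∙ (x₂ :∙ x₃))) (x₂ :∙ x₃) refl (b ∷ b′ ∷ d ∷ d′ ∷ []))
  ... | yes _ | no d″≁d = aligned l·b l·b′ l·d (·-shift l l·d l·b l·b′) b≁b′ (d″≁d ∘ sym)
                            (solve (x₀ :∙ x₁) (x₂ :∙ (x₂ :∙ (x₀ :∙ x₁))) refl (b ∷ b′ ∷ d ∷ d′ ∷ []))
  ... | yes b″≈b | yes d″≈d = aligned (·-shift l l·b l·d l·d′) l·b′ (·-shift l l·d l·b l·b′) l·d′
                                 (λ e → b≁b′ (trans (sym b″≈b) e)) (λ e → d≁d′ (trans (sym d″≈d) e))
                                 (solve (x₀ :∙ (x₂ :∙ x₃) :∙ x₁) (x₂ :∙ (x₀ :∙ x₁) :∙ x₃) refl (b ∷ b′ ∷ d ∷ d′ ∷ []))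

constant-on-both-sides : ∀ {n} {g : Subset n} {l t c} → ConstantOn g l t c → ConstantOn g l (not t) c → ∀ y → g y ≡ c
constant-on-both-sides {l = l} {t} on-t on-¬t y with l · y ≟ᵇ t
... | yes l·y≡t = on-t y l·y≡t
... | no l·y≢t = on-¬t y (¬-not l·y≢t)

parallel⇒monochromatic : ∀ {n} {f : Subset (suc n)} → FrameFree f → (l : Vec Bool n) → l ≢ 0v → ∀ {t₀ t₁ c₀ c₁} →
                         ConstantOn (slice false f) l t₀ c₀ → ConstantOn (slice true f) l t₁ c₁ → MonochromaticHyperplane f
parallel⇒monochromatic {f = f} frameFree l l≢0 {t₀} {t₁} {c₀} {c₁} constant₀ constant₁ with c₁ ≟ᵇ c₀
... | yes refl = glue l l≢0 t₀ t₁ c₀ constant₀ constant₁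
... | no c₁≢c₀ = opposite (λ y l·y → trans (constant₁ y l·y) (¬-not c₁≢c₀))
  where
  opposite : ConstantOn (slice true f) l t₁ (not c₀) → MonochromaticHyperplane f
  opposite constant₁ with constant-or-witness (λ y → l · y ≟ᵇ not t₀) (slice false f) c₀
  ... | inj₁ rest₀ = constant-slice⇒monochromatic false c₀ (constant-on-both-sides {l = l} constant₀ rest₀)
  ... | inj₂ (b , l·b , b∈) with constant-or-witness (λ y → l · y ≟ᵇ not t₀) (slice false f) (not c₀)
  ...   | inj₁ rest₀ = glue l l≢0 (not t₀) t₁ (not c₀) rest₀ constant₁
  ...   | inj₂ (b′ , l·b′ , b′∈) with constant-or-witness (λ y → l · y ≟ᵇ not t₁) (slice true f) (not c₀)
  ...     | inj₁ rest₁ = constant-slice⇒monochromatic true (not c₀) (constant-on-both-sides {l = l} constant₁ rest₁)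
  ...     | inj₂ (d , l·d , d∈) with constant-or-witness (λ y → l · y ≟ᵇ not t₁) (slice true f) c₀
  ...       | inj₁ rest₁ = glue l l≢0 t₀ (not t₁) c₀ constant₀ rest₁
  ...       | inj₂ (d′ , l·d′ , d′∈) = ⊥-elim (bichromatic⇒⊥ frameFree l≢0 constant₀ constant₁ l·b l·b′ l·d l·d′
                                           (λ e → not-¬ refl (trans (sym b∈) (trans e b′∈)))
                                           (λ e → not-¬ refl (trans (sym d′∈) (trans (sym e) d∈))))

record GreenPair {n} (g : Subset n) (p q : Point n) : Set where
  field
    g₀ g₁ : Point n
    g₀⊕g₁ : g₀ ⊕ g₁ ≡ p
    g₀∈g : g g₀ ≡ true
    g₁∈g : g g₁ ≡ true
    g₀⊕q∉g : g (g₀ ⊕ q) ≡ false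
    g₁⊕q∉g : g (g₁ ⊕ q) ≡ false
    g₀≢g₁ : g₀ ≢ g₁

-- Two points y₀, y₁ off a hyperplane of colour c that q moves onto it give
-- a green pair: y₀, y₁ themselves if c is red, y₀ + q, y₁ + q if c is green.
green-pair : ∀ {n} {g : Subset n} l₀ {e₀ c y₀ y₁ q} → ConstantOn g l₀ e₀ c →
             l₀ · y₀ ≡ not e₀ → l₀ · y₁ ≡ not e₀ → l₀ · q ≡ true → y₀ ≢ y₁ →
             g y₀ ≡ not c → g y₁ ≡ not c → GreenPair g (y₀ ⊕ y₁) q
green-pair l₀ {c = false} {y₀} {y₁} {q} constant l₀·y₀ l₀·y₁ l₀·q y₀≢y₁ y₀∈g y₁∈g = record
  { g₀ = y₀ ; g₁ = y₁ ; g₀⊕g₁ = refl ; g₀∈g = y₀∈g ; g₁∈g = y₁∈g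
  ; g₀⊕q∉g = constant (y₀ ⊕ q) (trans (·-pair l₀ l₀·y₀ l₀·q) (not-xor-true _))
  ; g₁⊕q∉g = constant (y₁ ⊕ q) (trans (·-pair l₀ l₀·y₁ l₀·q) (not-xor-true _))
  ; g₀≢g₁ = y₀≢y₁ }
green-pair {g = g} l₀ {c = true} {y₀} {y₁} {q} constant l₀·y₀ l₀·y₁ l₀·q y₀≢y₁ y₀∉g y₁∉g = record
  { g₀ = y₀ ⊕ q ; g₁ = y₁ ⊕ q
  ; g₀⊕g₁ = solve (x₀ :∙ x₂ :∙ (x₁ :∙ x₂)) (x₀ :∙ x₁) refl (y₀ ∷ y₁ ∷ q ∷ [])
  ; g₀∈g = constant (y₀ ⊕ q) (trans (·-pair l₀ l₀·y₀ l₀·q) (not-xor-true _))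
  ; g₁∈g = constant (y₁ ⊕ q) (trans (·-pair l₀ l₀·y₁ l₀·q) (not-xor-true _))
  ; g₀⊕q∉g = subst (λ y → g y ≡ false) (solve x₀ (x₀ :∙ x₁ :∙ x₁) refl (y₀ ∷ q ∷ [])) y₀∉g
  ; g₁⊕q∉g = subst (λ y → g y ≡ false) (solve x₀ (x₀ :∙ x₁ :∙ x₁) refl (y₁ ∷ q ∷ [])) y₁∉g
  ; g₀≢g₁ = λ e → y₀≢y₁ (⊕-cancelʳ e) }

cross-frame : ∀ {n} {f : Subset (suc n)} {p q} → FrameFree f →
              GreenPair (slice false f) p q → GreenPair (slice true f) q p → p ≢ q → ⊥
cross-frame {f = f} {p} {q} frameFree G H p≢q = frameFree {false ∷ g₀} {false ∷ g₁} {true ∷ h₀} {true ∷ h₁} record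
  { a∈G = g₀∈g ; b∈G = g₁∈g ; c∈G = h₀∈g ; d∈G = h₁∈g
  ; abc∉G = red (trans (solve (:sum₃ x₀ x₁ x₂) (x₂ :∙ (x₀ :∙ x₁)) refl ρ) (cong (h₀ ⊕_) g₀⊕g₁)) h₀⊕q∉g
  ; abd∉G = red (trans (solve (:sum₃ x₀ x₁ x₃) (x₃ :∙ (x₀ :∙ x₁)) refl ρ) (cong (h₁ ⊕_) g₀⊕g₁)) h₁⊕q∉g
  ; acd∉G = red (trans (solve (:sum₃ x₀ x₂ x₃) (x₀ :∙ (x₂ :∙ x₃)) refl ρ) (cong (g₀ ⊕_) h₀⊕h₁)) g₀⊕q∉g
  ; bcd∉G = red (trans (solve (:sum₃ x₁ x₂ x₃) (x₁ :∙ (x₂ :∙ x₃)) refl ρ) (cong (g₁ ⊕_) h₀⊕h₁)) g₁⊕q∉g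
  ; a≢b = g₀≢g₁ ∘ ∷-injectiveʳ ; c≢d = h₀≢h₁ ∘ ∷-injectiveʳ
  ; a≢c = λ () ; a≢d = λ () ; b≢c = λ () ; b≢d = λ ()
  ; sum₄≢0 = λ e → p≢q (⊕≡0⇒≡ (trans (cong₂ _⊕_ (sym g₀⊕g₁) (sym h₀⊕h₁))
                                      (trans (solve (x₀ :∙ x₁ :∙ (x₂ :∙ x₃)) (:sum₄ x₀ x₁ x₂ x₃) refl ρ) (∷-injectiveʳ e))))
  }
  where
  open GreenPair G
  open GreenPair H renaming (g₀ to h₀; g₁ to h₁; g₀⊕g₁ to h₀⊕h₁; g₀∈g to h₀∈g; g₁∈g to h₁∈g;
                             g₀⊕q∉g to h₀⊕q∉g; g₁⊕q∉g to h₁⊕q∉g; g₀≢g₁ to h₀≢h₁)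
  ρ : Vec (Point _) 4
  ρ = g₀ ∷ g₁ ∷ h₀ ∷ h₁ ∷ []
  red : ∀ {β x y} → x ≡ y → f (β ∷ y) ≡ false → f (β ∷ x) ≡ false
  red refl y∉f = y∉f

constant-beyond : ∀ {n} {g : Subset n} l₀ {e₀} l₁ {t c} → ConstantOn g l₀ e₀ c →
                  (∀ y → l₀ · y ≡ not e₀ × l₁ · y ≡ t → g y ≡ c) → ConstantOn g l₁ t c
constant-beyond l₀ {e₀} l₁ on-hyperplane off-hyperplane y l₁·y with l₀ · y ≟ᵇ e₀
... | yes l₀·y≡e₀ = on-hyperplane y l₀·y≡e₀
... | no l₀·y≢e₀ = off-hyperplane y (¬-not l₀·y≢e₀ , l₁·y)

-- Either one slice is constant on a hyperplane parallel to the other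
-- slice's, or both are bichromatic off their own hyperplanes on both sides
-- of the other's, and then the two slices contain a frame.
slices⇒monochromatic : ∀ {n} {f : Subset (suc n)} → FrameFree f → ∀ {l₀ e₀ c₀ l₁ e₁ c₁} → l₀ ≢ 0v → l₁ ≢ 0v →
                       ConstantOn (slice false f) l₀ e₀ c₀ → ConstantOn (slice true f) l₁ e₁ c₁ →
                       MonochromaticHyperplane f
slices⇒monochromatic {f = f} frameFree {l₀} {e₀} {c₀} {l₁} {e₁} {c₁} l₀≢0 l₁≢0 constant₀ constant₁
  with constant-or-witness (λ y → (l₀ · y ≟ᵇ not e₀) ×-dec (l₁ · y ≟ᵇ false)) (slice false f) c₀
... | inj₁ rest = parallel⇒monochromatic frameFree l₁ l₁≢0 (constant-beyond l₀ l₁ constant₀ rest) constant₁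
... | inj₂ (y₀ , (l₀·y₀ , l₁·y₀) , y₀∈)
  with constant-or-witness (λ y → (l₀ · y ≟ᵇ not e₀) ×-dec (l₁ · y ≟ᵇ true)) (slice false f) c₀
...   | inj₁ rest = parallel⇒monochromatic frameFree l₁ l₁≢0 (constant-beyond l₀ l₁ constant₀ rest) constant₁
...   | inj₂ (y₁ , (l₀·y₁ , l₁·y₁) , y₁∈)
  with constant-or-witness (λ z → (l₁ · z ≟ᵇ not e₁) ×-dec (l₀ · z ≟ᵇ false)) (slice true f) c₁
...     | inj₁ rest = parallel⇒monochromatic frameFree l₀ l₀≢0 constant₀ (constant-beyond l₁ l₀ constant₁ rest)
...     | inj₂ (z₀ , (l₁·z₀ , l₀·z₀) , z₀∈)
  with constant-or-witness (λ z → (l₁ · z ≟ᵇ not e₁) ×-dec (l₀ · z ≟ᵇ true)) (slice true f) c₁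
...       | inj₁ rest = parallel⇒monochromatic frameFree l₀ l₀≢0 constant₀ (constant-beyond l₁ l₀ constant₁ rest)
...       | inj₂ (z₁ , (l₁·z₁ , l₀·z₁) , z₁∈) =
  ⊥-elim (cross-frame frameFree (green-pair l₀ constant₀ l₀·y₀ l₀·y₁ l₀·z₀⊕z₁ y₀≢y₁ y₀∈ y₁∈)
                                (green-pair l₁ constant₁ l₁·z₀ l₁·z₁ l₁·y₀⊕y₁ z₀≢z₁ z₀∈ z₁∈)
                                y₀⊕y₁≢z₀⊕z₁)
  where
  l₀·z₀⊕z₁ : l₀ · (z₀ ⊕ z₁) ≡ true
  l₀·z₀⊕z₁ = ·-pair l₀ l₀·z₀ l₀·z₁
  l₁·y₀⊕y₁ : l₁ · (y₀ ⊕ y₁) ≡ true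
  l₁·y₀⊕y₁ = ·-pair l₁ l₁·y₀ l₁·y₁
  y₀≢y₁ : y₀ ≢ y₁
  y₀≢y₁ = ·-separates l₁ λ e → not-¬ l₁·y₀ (trans e l₁·y₁)
  z₀≢z₁ : z₀ ≢ z₁
  z₀≢z₁ = ·-separates l₀ λ e → not-¬ l₀·z₀ (trans e l₀·z₁)
  y₀⊕y₁≢z₀⊕z₁ : y₀ ⊕ y₁ ≢ z₀ ⊕ z₁
  y₀⊕y₁≢z₀⊕z₁ = ·-separates l₁ λ e → not-¬ l₁·y₀⊕y₁ (trans e (trans (·-pair l₁ l₁·z₀ l₁·z₁) (xor-same (not e₁))))

frameFree⇒monochromatic : ∀ n {f : Subset (suc n)} → FrameFree f → MonochromaticHyperplane f
frameFree⇒monochromatic zero {f} _ = constant-slice⇒monochromatic false (f (false ∷ [])) λ { [] → refl }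
frameFree⇒monochromatic (suc n) frameFree
  with record { normal≢0 = l₀≢0 ; constant = constant₀ } ← frameFree⇒monochromatic n (frameFree-slice false frameFree)
     | record { normal≢0 = l₁≢0 ; constant = constant₁ } ← frameFree⇒monochromatic n (frameFree-slice true frameFree)
  = slices⇒monochromatic frameFree l₀≢0 l₁≢0 constant₀ constant₁

-- Hyperplanes as copies of GF(2)^n

·-removeAt : ∀ {n} (l x : Vec Bool (suc n)) j → l · x ≡ (lookup l j ∧ lookup x j) xor (removeAt l j · removeAt x j)
·-removeAt (a ∷ l) (x ∷ y) zero = refl
·-removeAt (a ∷ l@(_ ∷ _)) (x ∷ y@(_ ∷ _)) (suc j) =
  trans (cong ((a ∧ x) xor_) (·-removeAt l y j))
        (solveᵇ (b₀ :xor (b₁ :xor b₂)) (b₁ :xor (b₀ :xor b₂)) refl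
                 (a ∧ x ∷ lookup l j ∧ lookup y j ∷ removeAt l j · removeAt y j ∷ []))

insertAt-⊕ : ∀ {n} (x y : Vec Bool n) j a b → insertAt x j a ⊕ insertAt y j b ≡ insertAt (x ⊕ y) j (a xor b)
insertAt-⊕ x y zero a b = refl
insertAt-⊕ (u ∷ x) (v ∷ y) (suc j) a b = cong ((u xor v) ∷_) (insertAt-⊕ x y j a b)

insertAt-0v : ∀ {n} (j : Fin (suc n)) → insertAt 0v j false ≡ 0v
insertAt-0v zero = refl
insertAt-0v {suc n} (suc j) = cong (false ∷_) (insertAt-0v j)

insertAt-sum₃ : ∀ {n} (a b c : Vec Bool n) j p q r →
                sum₃ (insertAt a j p) (insertAt b j q) (insertAt c j r) ≡ insertAt (sum₃ a b c) j (p xor (q xor (r xor false)))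
insertAt-sum₃ a b c j p q r = begin
  A ⊕ (B ⊕ (C ⊕ 0v))                               ≡⟨ cong (λ z → A ⊕ (B ⊕ (C ⊕ z))) (sym (insertAt-0v j)) ⟩
  A ⊕ (B ⊕ (C ⊕ insertAt 0v j false))              ≡⟨ cong (λ z → A ⊕ (B ⊕ z)) (insertAt-⊕ c 0v j r false) ⟩
  A ⊕ (B ⊕ insertAt (c ⊕ 0v) j (r xor false))      ≡⟨ cong (A ⊕_) (insertAt-⊕ b (c ⊕ 0v) j q (r xor false)) ⟩
  A ⊕ insertAt (b ⊕ (c ⊕ 0v)) j (q xor (r xor false)) ≡⟨ insertAt-⊕ a (b ⊕ (c ⊕ 0v)) j p (q xor (r xor false)) ⟩
  insertAt (sum₃ a b c) j (p xor (q xor (r xor false))) ∎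
  where
  open ≡-Reasoning
  A = insertAt a j p
  B = insertAt b j q
  C = insertAt c j r

pivot : ∀ {n} (l : Vec Bool n) → l ≢ 0v → ∃[ j ] lookup l j ≡ true
pivot [] l≢0 = ⊥-elim (l≢0 refl)
pivot (true ∷ l) _ = zero , refl
pivot (false ∷ l) l≢0 with j , lⱼ ← pivot l (l≢0 ∘ cong (false ∷_)) = suc j , lⱼ

-- The hyperplane l · x ≡ e of GF(2)^(n+1), parametrised by GF(2)^n through
-- the coordinates other than a pivot j of l.
module HyperplaneChart {n} (l : Vec Bool (suc n)) (j : Fin (suc n)) (lⱼ : lookup l j ≡ true) (e : Bool) where

  chart : Point n → Point (suc n)
  chart y = insertAt y j (e xor (removeAt l j · y))

  chart-onto : ∀ x → l · x ≡ e → chart (removeAt x j) ≡ x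
  chart-onto x l·x≡e = trans (cong (insertAt (removeAt x j) j) xⱼ) (insertAt-removeAt x j)
    where
    xⱼ : e xor (removeAt l j · removeAt x j) ≡ lookup x j
    xⱼ = begin
      e xor r                                  ≡⟨ cong (_xor r) (sym l·x≡e) ⟩
      l · x xor r                              ≡⟨ cong (_xor r) (·-removeAt l x j) ⟩
      ((lookup l j ∧ lookup x j) xor r) xor r  ≡⟨ cong (λ b → ((b ∧ lookup x j) xor r) xor r) lⱼ ⟩
      (lookup x j xor r) xor r                 ≡⟨ solveᵇ ((b₀ :xor b₁) :xor b₁) b₀ refl (lookup x j ∷ r ∷ []) ⟩
      lookup x j                               ∎
      where
      open ≡-Reasoning
      r = removeAt l j · removeAt x j

  chart-affine : ∀ a b c → chart (sum₃ a b c) ≡ sum₃ (chart a) (chart b) (chart c)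
  chart-affine a b c = begin
    chart (sum₃ a b c)
      ≡⟨ cong (insertAt (sum₃ a b c) j) offset-affine ⟩
    insertAt (sum₃ a b c) j (β a xor (β b xor (β c xor false)))
      ≡⟨ sym (insertAt-sum₃ a b c j (β a) (β b) (β c)) ⟩
    sum₃ (chart a) (chart b) (chart c)
      ∎
    where
    open ≡-Reasoning
    l′ = removeAt l j
    β : Point n → Bool
    β y = e xor (l′ · y)
    offset-affine : β (sum₃ a b c) ≡ β a xor (β b xor (β c xor false))
    offset-affine = trans (cong (e xor_) (·-sumV l′ (a ∷ b ∷ c ∷ [])))
      (solveᵇ (b₀ :xor :xor₃ b₁ b₂ b₃) (:xor₃ (b₀ :xor b₁) (b₀ :xor b₂) (b₀ :xor b₃)) refl
               (e ∷ l′ · a ∷ l′ · b ∷ l′ · c ∷ []))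

  chart-injective : Injective _≡_ _≡_ chart
  chart-injective {y} {y′} e =
    trans (sym (removeAt-insertAt y j _)) (trans (cong (λ x → removeAt x j) e) (removeAt-insertAt y′ j _))

  chart-frameFree : ∀ {f : Subset (suc n)} → FrameFree f → FrameFree (f ∘ chart)
  chart-frameFree = frameFree-pullback chart chart-affine chart-injective

·-insertAt-false : ∀ {n} (l : Vec Bool n) x j → insertAt l j false · x ≡ l · removeAt x j
·-insertAt-false l x j = begin
  insertAt l j false · x
    ≡⟨ ·-removeAt (insertAt l j false) x j ⟩
  (lookup (insertAt l j false) j ∧ lookup x j) xor (removeAt (insertAt l j false) j · removeAt x j)
    ≡⟨ cong₂ (λ a l′ → (a ∧ lookup x j) xor (l′ · removeAt x j)) (insertAt-lookup l j false) (removeAt-insertAt l j false) ⟩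
  l · removeAt x j
    ∎
  where open ≡-Reasoning

liftEntry : ∀ {n} → Fin (suc n) → Vec Bool n × Bool × Bool → Vec Bool (suc n) × Bool × Bool
liftEntry j (l , e , c) = insertAt l j false , e , c

decide-liftEntry : ∀ {n} j (L : DecisionList n) c₀ x → decide (map (liftEntry j) L) c₀ x ≡ decide L c₀ (removeAt x j)
decide-liftEntry j [] c₀ x = refl
decide-liftEntry j ((l , e , c) ∷ L) c₀ x =
  cong₂ (λ b r → if b then c else r) (cong (λ v → does (v ≟ᵇ e)) (·-insertAt-false l x j)) (decide-liftEntry j L c₀ x)

frameFree⇒decisionList : ∀ n {f : Subset n} → FrameFree f → ∃[ L ] ∃[ c₀ ] (∀ x → decide L c₀ x ≡ f x)
frameFree⇒decisionList zero {f} _ = [] , f [] , λ { [] → refl }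
frameFree⇒decisionList (suc n) {f} frameFree
  with record { normal = l ; offset = e ; colour = c ; normal≢0 = l≢0 ; constant = constant } ← frameFree⇒monochromatic n frameFree
  with j , lⱼ ← pivot l l≢0
  with L , c₀ , decides ← frameFree⇒decisionList n (HyperplaneChart.chart-frameFree l j lⱼ (not e) frameFree)
  = (l , e , c) ∷ map (liftEntry j) L , c₀ , decides′
  where
  open HyperplaneChart l j lⱼ (not e)
  decides′ : ∀ x → decide ((l , e , c) ∷ map (liftEntry j) L) c₀ x ≡ f x
  decides′ x with l · x ≟ᵇ e
  ... | yes l·x≡e = sym (constant x l·x≡e)
  ... | no l·x≢e = begin
    decide (map (liftEntry j) L) c₀ x               ≡⟨ decide-liftEntry j L c₀ x ⟩
    decide L c₀ (removeAt x j)                     ≡⟨ decides (removeAt x j) ⟩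
    f (chart (removeAt x j))                       ≡⟨ cong f (chart-onto x (¬-not l·x≢e)) ⟩
    f x                                            ∎
    where open ≡-Reasoning

theorem1p3 : (n : ℕ) (G : Subset n) → IsAffineTarget G ⇔ (¬ ContainsU44Induced G)
theorem1p3 n G = mk⇔ target⇒noU44 noU44⇒target
  where
  target⇒noU44 : IsAffineTarget G → ¬ ContainsU44Induced G
  target⇒noU44 target u44 with _ , _ , _ , _ , frame ← containsU44⇒frame u44 =
    chain⇒frameFree (target⇒chain target) frame

  noU44⇒target : ¬ ContainsU44Induced G → IsAffineTarget G
  noU44⇒target noU44 with L , c₀ , decides ← frameFree⇒decisionList n (noU44 ∘ frame⇒containsU44) =
    chain⇒target (chain-resp decides (decisionList⇒chain (λ _ _ _ → refl) L c₀))
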